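{- Let $F$ and $G$ be disjoint polyboxes in a $d$-box $X$. Suppose there are proper suits $\mathcal{F}$ for $F$ and $\mathcal{G}$ for $G$ such that $\mathcal{F}\cup\mathcal{G}$ is a suit (for $F\cup G$). Then for every proper suit $\mathcal{F}^*$ for $F$ and every proper suit $\mathcal{G}^*$ for $G$, the family $\mathcal{F}^*\cup\mathcal{G}^*$ is a suit for $F\cup G$.
   Context: A $d$-box is $X=X_1\times\cdots\times X_d$ with finite nonempty sets $X_i$. A box is a nonempty $A_1\times\cdots\times A_d$ with $A_i\subseteq X_i$, proper if $A_i\neq X_i$ for all $i$. Boxes $A,B$ are dichotomous if $A_i=X_i\setminus B_i$ for some $i$. A suit is a family of pairwise dichotomous boxes, proper if all its boxes are proper, and a suit for $F$ if its union is $F$; a nonempty $F\subseteq X$ is a polybox if it has a suit. -}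

module Defs where

open import Level using (0ℓ)
open import Data.Nat using (ℕ; _<_)
open import Data.Fin using (Fin)
open import Data.Fin.Subset using (Subset; ∁; ⊤; Nonempty) renaming (_∈_ to _∈ₛ_)
open import Data.List using (List)
open import Data.List.Membership.Propositional using (_∈_)
open import Data.List.Relation.Unary.Any using (Any)
open import Data.Product using (Σ; ∃; _×_)
open import Relation.Binary.PropositionalEquality using (_≡_; _≢_)
open import Relation.Unary using (Pred)
open import Relation.Nullary using (¬_)
open import Data.Empty using (⊥)

-- A d-box X = X_0 × ... × X_{d-1}, with X_i = Fin (n i); nonemptiness of the
-- X_i is a separate hypothesis (0 < n i) in the statement.
Point : (d : ℕ) → (Fin d → ℕ) → Set
Point d n = (i : Fin d) → Fin (n i)

Cube : (d : ℕ) → (Fin d → ℕ) → Set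
Cube d n = (i : Fin d) → Subset (n i)

module _ {d : ℕ} {n : Fin d → ℕ} where

  IsBox : Cube d n → Set
  IsBox A = (i : Fin d) → Nonempty (A i)

  IsProper : Cube d n → Set
  IsProper A = (i : Fin d) → A i ≢ ⊤

  Dichotomous : Cube d n → Cube d n → Set
  Dichotomous A B = Σ (Fin d) λ i → A i ≡ ∁ (B i)

  _∈box_ : Point d n → Cube d n → Set
  x ∈box A = (i : Fin d) → x i ∈ₛ A i

  -- A family of boxes is given as a list (duplicates are harmless: the family
  -- is the set of list members). Pairwise dichotomous = any two distinct members
  -- are dichotomous.
  IsSuit : List (Cube d n) → Set
  IsSuit 𝓕 = ((A : Cube d n) → A ∈ 𝓕 → IsBox A)
           × ((A B : Cube d n) → A ∈ 𝓕 → B ∈ 𝓕 → A ≢ B → Dichotomous A B)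

  IsProperSuit : List (Cube d n) → Set
  IsProperSuit 𝓕 = IsSuit 𝓕 × ((A : Cube d n) → A ∈ 𝓕 → IsProper A)

  UnionIs : List (Cube d n) → Pred (Point d n) 0ℓ → Set
  UnionIs 𝓕 F = (x : Point d n) → (F x → Any (x ∈box_) 𝓕) × (Any (x ∈box_) 𝓕 → F x)

  IsSuitFor : List (Cube d n) → Pred (Point d n) 0ℓ → Set
  IsSuitFor 𝓕 F = IsSuit 𝓕 × UnionIs 𝓕 F

  IsProperSuitFor : List (Cube d n) → Pred (Point d n) 0ℓ → Set
  IsProperSuitFor 𝓕 F = IsProperSuit 𝓕 × UnionIs 𝓕 F

  IsPolybox : Pred (Point d n) 0ℓ → Set
  IsPolybox F = (∃ λ x → F x) × (∃ λ 𝓕 → IsSuitFor 𝓕 F)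

  Disjoint : Pred (Point d n) 0ℓ → Pred (Point d n) 0ℓ → Set
  Disjoint F G = (x : Point d n) → F x → G x → ⊥

-- Suppose a box A of 𝓕* were not dichotomous to a box D of 𝓖. In every
-- coordinate k choose an integer weight on X_k of mass 1 on A_k and mass 0 on
-- the complements of A_k and of D_k: a point of A_k ∩ D_k if there is one, and
-- otherwise a + b - c with a ∈ A_k, b ∈ D_k and c outside both (c exists since
-- A_k ≠ ∁ D_k). Under the product weight μ a box C has measure ∏_k mass(C_k),
-- so μ vanishes on every box dichotomous to D or to A, while μ(A) = 1. Boxes of
-- a suit are disjoint, hence μ(⋃ 𝓕) = 0 because every box of 𝓕 is dichotomous
-- to D, whereas μ(⋃ 𝓕*) = μ(A) = 1 because every other box of 𝓕* is A itself
-- or dichotomous to A; but ⋃ 𝓕 = F = ⋃ 𝓕*. So every box of 𝓕* is dichotomous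
-- to every box of 𝓖 (a box of 𝓖 is dichotomous to the boxes of 𝓕, from which
-- it differs as F ∩ G = ∅), and the same argument with 𝓖, 𝓖* in place of
-- 𝓕, 𝓕* finishes the proof.

module Submission where

open import Level using (Level; 0ℓ)
open import Function using (_∘_)
open import Data.Bool using (if_then_else_)
import Data.Bool.Properties as Bool
open import Data.Nat using (ℕ; zero; suc; _<_)
open import Data.Fin using (Fin; zero; suc)
open import Data.Fin.Properties using (_≟_; any?; all?)
open import Data.Fin.Subset using (Subset; ∁; _∉_) renaming (_∈_ to _∈ₛ_)
open import Data.Fin.Subset.Properties
  using (_∈?_; ⊆-antisym; x∈p⇒x∉∁p; x∈∁p⇒x∉p; x∉p⇒x∈∁p; ∪-∩-booleanAlgebra)
open import Data.Vec.Properties using (≡-dec)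
open import Data.Integer using (ℤ; _+_; _*_; -_; _-_; 0ℤ; 1ℤ; -1ℤ)
open import Data.Integer.Properties
  using (+-*-semiring; *-1-commutativeMonoid; +-identityˡ; +-identityʳ; *-identityˡ;
         *-identityʳ; *-zeroˡ; *-zeroʳ; *-distribˡ-+; *-distribʳ-+; neg-distribʳ-*; -1*i≡-i)
open import Data.Product using (∃; _×_; _,_; proj₁; proj₂)
open import Data.Sum as Sum using (inj₁; inj₂; [_,_]′)
open import Data.Empty using (⊥-elim)
open import Data.List using (List; []; _∷_; _++_; filter)
open import Data.List.Membership.Propositional using (_∈_; find; lose)
open import Data.List.Membership.Propositional.Properties
  using (∈-filter⁺; ∈-filter⁻; ∈-++⁻; ∈-++⁺ˡ; ∈-++⁺ʳ)
open import Data.List.Relation.Unary.Any as Any using (Any; here; there)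
open import Data.List.Relation.Unary.Any.Properties using (++⁺ˡ; ++⁺ʳ; ++⁻)
open import Data.List.Relation.Unary.All as All using (All)
open import Data.List.Relation.Unary.All.Properties using (¬All⇒Any¬)
open import Relation.Binary.PropositionalEquality
open import Relation.Nullary
  using (¬_; ¬?; Dec; yes; no; does; _×-dec_; _⊎-dec_; decidable-stable)
open import Relation.Unary using (Pred; Decidable; _∪_; _⊆_; _≐_)
open import Relation.Unary.Properties using (_∪?_)
open import Algebra.Properties.Semiring.Sum +-*-semiring
  using (sum; sum-cong-≗; sum-replicate-zero; ∑-distrib-+; *-distribˡ-sum; *-distribʳ-sum)
open import Algebra.Properties.CommutativeMonoid.Sum *-1-commutativeMonoid
  using ()
  renaming (sum to ∏; sum-cong-≗ to ∏-cong-≗; sum-replicate-zero to ∏-replicate-one;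
            ∑-distrib-+ to ∏-distrib-*)
import Algebra.Lattice.Properties.BooleanAlgebra as BooleanAlgebraProperties

open import Defs

private
  variable
    p q : Level
    P Q : Set p

-- Defined through 'does' alone so that δ (suc u) (suc v) reduces to δ u v.
𝟙 : Dec P → ℤ
𝟙 P? = if does P? then 1ℤ else 0ℤ

𝟙-yes : P → (P? : Dec P) → 𝟙 P? ≡ 1ℤ
𝟙-yes _ (yes _) = refl
𝟙-yes p (no ¬p) = ⊥-elim (¬p p)

𝟙-no : ¬ P → (P? : Dec P) → 𝟙 P? ≡ 0ℤ
𝟙-no ¬p (yes p) = ⊥-elim (¬p p)
𝟙-no _ (no _) = refl

𝟙-cong : (P → Q) → (Q → P) → (P? : Dec P) (Q? : Dec Q) → 𝟙 P? ≡ 𝟙 Q?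
𝟙-cong P→Q _ (yes p) Q? = sym (𝟙-yes (P→Q p) Q?)
𝟙-cong _ Q→P (no ¬p) Q? = sym (𝟙-no (¬p ∘ Q→P) Q?)

𝟙-⊎ : ¬ (P × Q) → (P? : Dec P) (Q? : Dec Q) → 𝟙 (P? ⊎-dec Q?) ≡ 𝟙 P? + 𝟙 Q?
𝟙-⊎ P∩Q=∅ (yes p) (yes q) = ⊥-elim (P∩Q=∅ (p , q))
𝟙-⊎ _ (yes _) (no _) = refl
𝟙-⊎ _ (no _) (yes _) = refl
𝟙-⊎ _ (no _) (no _) = refl

∏-zero : ∀ {d} (f : Fin d → ℤ) k → f k ≡ 0ℤ → ∏ f ≡ 0ℤ
∏-zero f zero f0≡0 = trans (cong (_* ∏ (f ∘ suc)) f0≡0) (*-zeroˡ (∏ (f ∘ suc)))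
∏-zero f (suc k) fk≡0 = trans (cong (f zero *_) (∏-zero (f ∘ suc) k fk≡0)) (*-zeroʳ (f zero))

𝟙-∀ : ∀ {d} {P : Pred (Fin d) p} (P? : Decidable P) (∀P? : Dec (∀ i → P i)) →
      𝟙 ∀P? ≡ ∏ (𝟙 ∘ P?)
𝟙-∀ {d = zero} _ ∀P? = 𝟙-yes (λ ()) ∀P?
𝟙-∀ {d = suc d} {P = P} P? ∀P? with P? zero
... | yes P0 = begin
  𝟙 ∀P?                 ≡⟨ 𝟙-cong (_∘ suc) extend ∀P? (all? (P? ∘ suc)) ⟩
  𝟙 (all? (P? ∘ suc))   ≡⟨ 𝟙-∀ (P? ∘ suc) (all? (P? ∘ suc)) ⟩
  ∏ (𝟙 ∘ P? ∘ suc)      ≡⟨ *-identityˡ _ ⟨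
  1ℤ * ∏ (𝟙 ∘ P? ∘ suc) ∎
  where
  open ≡-Reasoning
  extend : (∀ i → P (suc i)) → ∀ i → P i
  extend _ zero = P0
  extend ∀P (suc i) = ∀P i
... | no ¬P0 = 𝟙-no (λ ∀P → ¬P0 (∀P zero)) ∀P?

𝟙-∈ : ∀ {m} {v : Fin m} {T} → v ∈ₛ T → 𝟙 (v ∈? T) ≡ 1ℤ
𝟙-∈ {v = v} {T} v∈T = 𝟙-yes v∈T (v ∈? T)

𝟙-∉ : ∀ {m} {v : Fin m} {T} → v ∉ T → 𝟙 (v ∈? T) ≡ 0ℤ
𝟙-∉ {v = v} {T} v∉T = 𝟙-no v∉T (v ∈? T)

mass : ∀ {m} → Subset m → (Fin m → ℤ) → ℤ
mass S u = sum λ v → 𝟙 (v ∈? S) * u v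

δ : ∀ {m} → Fin m → Fin m → ℤ
δ u v = 𝟙 (u ≟ v)

sum-δ : ∀ {m} (f : Fin m → ℤ) u → sum (λ v → f v * δ u v) ≡ f u
sum-δ {suc m} f zero = begin
  f zero * 1ℤ + sum (λ v → f (suc v) * 0ℤ)
    ≡⟨ cong₂ _+_ (*-identityʳ (f zero)) (sum-cong-≗ {m} (*-zeroʳ ∘ f ∘ suc)) ⟩
  f zero + sum (λ (_ : Fin m) → 0ℤ)
    ≡⟨ cong (f zero +_) (sum-replicate-zero m) ⟩
  f zero + 0ℤ
    ≡⟨ +-identityʳ _ ⟩
  f zero
    ∎
  where open ≡-Reasoning
sum-δ f (suc u) = begin
  f zero * 0ℤ + sum (λ v → f (suc v) * δ u v)
    ≡⟨ cong (_+ sum (λ v → f (suc v) * δ u v)) (*-zeroʳ (f zero)) ⟩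
  0ℤ + sum (λ v → f (suc v) * δ u v)
    ≡⟨ +-identityˡ _ ⟩
  sum (λ v → f (suc v) * δ u v)
    ≡⟨ sum-δ (f ∘ suc) u ⟩
  f (suc u)
    ∎
  where open ≡-Reasoning

mass-δ : ∀ {m} (T : Subset m) u → mass T (δ u) ≡ 𝟙 (u ∈? T)
mass-δ T = sum-δ (λ v → 𝟙 (v ∈? T))

mass-+ : ∀ {m} (T : Subset m) u₁ u₂ → mass T (λ v → u₁ v + u₂ v) ≡ mass T u₁ + mass T u₂
mass-+ T u₁ u₂ = trans
  (sum-cong-≗ λ v → *-distribˡ-+ (𝟙 (v ∈? T)) (u₁ v) (u₂ v))
  (∑-distrib-+ (λ v → 𝟙 (v ∈? T) * u₁ v) (λ v → 𝟙 (v ∈? T) * u₂ v))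

mass-neg : ∀ {m} (T : Subset m) u → mass T (λ v → - u v) ≡ - mass T u
mass-neg T u = begin
  sum (λ v → 𝟙 (v ∈? T) * - u v)
    ≡⟨ sum-cong-≗ (λ v → trans (sym (neg-distribʳ-* (𝟙 (v ∈? T)) (u v))) (sym (-1*i≡-i _))) ⟩
  sum (λ v → -1ℤ * (𝟙 (v ∈? T) * u v))
    ≡⟨ *-distribˡ-sum -1ℤ (λ v → 𝟙 (v ∈? T) * u v) ⟨
  -1ℤ * mass T u
    ≡⟨ -1*i≡-i _ ⟩
  - mass T u
    ∎
  where open ≡-Reasoning

record SeparatingWeight {m} (S R : Subset m) : Set where
  field
    weight : Fin m → ℤ
    mass-S : mass S weight ≡ 1ℤ
    mass-∁S : mass (∁ S) weight ≡ 0ℤ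
    mass-∁R : mass (∁ R) weight ≡ 0ℤ

separatingWeight : ∀ {m} {S R : Subset m} {a b} →
                   a ∈ₛ S → b ∈ₛ R → S ≢ ∁ R → SeparatingWeight S R
separatingWeight {S = S} {R} {a} {b} a∈S b∈R S≢∁R with any? (λ u → (u ∈? S) ×-dec (u ∈? R))
... | yes (u , u∈S , u∈R) = record
  { weight = δ u
  ; mass-S = trans (mass-δ S u) (𝟙-∈ u∈S)
  ; mass-∁S = trans (mass-δ (∁ S) u) (𝟙-∉ (x∈p⇒x∉∁p u∈S))
  ; mass-∁R = trans (mass-δ (∁ R) u) (𝟙-∉ (x∈p⇒x∉∁p u∈R))
  }
... | no S∩R=∅ with any? (λ c → ¬? (c ∈? S) ×-dec ¬? (c ∈? R))
...   | yes (c , c∉S , c∉R) = record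
  { weight = w
  ; mass-S = mass-w S (𝟙-∈ a∈S) (𝟙-∉ b∉S) (𝟙-∉ c∉S)
  ; mass-∁S = mass-w (∁ S) (𝟙-∉ (x∈p⇒x∉∁p a∈S)) (𝟙-∈ (x∉p⇒x∈∁p b∉S)) (𝟙-∈ (x∉p⇒x∈∁p c∉S))
  ; mass-∁R = mass-w (∁ R) (𝟙-∈ (x∉p⇒x∈∁p a∉R)) (𝟙-∉ (x∈p⇒x∉∁p b∈R)) (𝟙-∈ (x∉p⇒x∈∁p c∉R))
  }
  where
  w : Fin _ → ℤ
  w v = δ a v + δ b v - δ c v
  a∉R : a ∉ R
  a∉R a∈R = S∩R=∅ (a , a∈S , a∈R)
  b∉S : b ∉ S
  b∉S b∈S = S∩R=∅ (b , b∈S , b∈R)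
  mass-w : ∀ T {i j k} → 𝟙 (a ∈? T) ≡ i → 𝟙 (b ∈? T) ≡ j → 𝟙 (c ∈? T) ≡ k →
           mass T w ≡ i + j - k
  mass-w T refl refl refl = begin
    mass T w
      ≡⟨ mass-+ T _ _ ⟩
    mass T (λ v → δ a v + δ b v) + mass T (λ v → - δ c v)
      ≡⟨ cong₂ _+_ (mass-+ T (δ a) (δ b)) (mass-neg T (δ c)) ⟩
    mass T (δ a) + mass T (δ b) - mass T (δ c)
      ≡⟨ cong₂ _-_ (cong₂ _+_ (mass-δ T a) (mass-δ T b)) (mass-δ T c) ⟩
    𝟙 (a ∈? T) + 𝟙 (b ∈? T) - 𝟙 (c ∈? T)
      ∎
    where open ≡-Reasoning
...   | no S∪R=⊤ = ⊥-elim (S≢∁R (⊆-antisym S⊆∁R ∁R⊆S))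
  where
  S⊆∁R : ∀ {v} → v ∈ₛ S → v ∈ₛ ∁ R
  S⊆∁R {v} v∈S = x∉p⇒x∈∁p λ v∈R → S∩R=∅ (v , v∈S , v∈R)
  ∁R⊆S : ∀ {v} → v ∈ₛ ∁ R → v ∈ₛ S
  ∁R⊆S {v} v∈∁R = decidable-stable (v ∈? S) λ v∉S → S∪R=⊤ (v , v∉S , x∈∁p⇒x∉p v∈∁R)

_∷ₚ_ : ∀ {d} {n : Fin (suc d) → ℕ} → Fin (n zero) → Point d (n ∘ suc) → Point (suc d) n
(v ∷ₚ x) zero = v
(v ∷ₚ x) (suc i) = x i

∑ₚ : ∀ {d} {n : Fin d → ℕ} → (Point d n → ℤ) → ℤ
∑ₚ {zero} f = f λ ()
∑ₚ {suc d} f = sum λ v → ∑ₚ λ x → f (v ∷ₚ x)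

∑ₚ-cong : ∀ {d n} {f g : Point d n → ℤ} → (∀ x → f x ≡ g x) → ∑ₚ f ≡ ∑ₚ g
∑ₚ-cong {zero} f≗g = f≗g _
∑ₚ-cong {suc d} f≗g = sum-cong-≗ λ v → ∑ₚ-cong λ x → f≗g (v ∷ₚ x)

∑ₚ-distrib-+ : ∀ {d n} (f g : Point d n → ℤ) → ∑ₚ (λ x → f x + g x) ≡ ∑ₚ f + ∑ₚ g
∑ₚ-distrib-+ {zero} f g = refl
∑ₚ-distrib-+ {suc d} f g = trans
  (sum-cong-≗ λ v → ∑ₚ-distrib-+ (f ∘ (v ∷ₚ_)) (g ∘ (v ∷ₚ_)))
  (∑-distrib-+ (λ v → ∑ₚ (f ∘ (v ∷ₚ_))) (λ v → ∑ₚ (g ∘ (v ∷ₚ_))))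

*-distribˡ-∑ₚ : ∀ {d n} c (f : Point d n → ℤ) → c * ∑ₚ f ≡ ∑ₚ (λ x → c * f x)
*-distribˡ-∑ₚ {zero} c f = refl
*-distribˡ-∑ₚ {suc d} c f = trans
  (*-distribˡ-sum c (λ v → ∑ₚ (f ∘ (v ∷ₚ_))))
  (sum-cong-≗ λ v → *-distribˡ-∑ₚ c (f ∘ (v ∷ₚ_)))

∑ₚ-∏ : ∀ {d} {n : Fin d → ℕ} (f : (k : Fin d) → Fin (n k) → ℤ) →
       ∑ₚ (λ x → ∏ λ k → f k (x k)) ≡ ∏ λ k → sum (f k)
∑ₚ-∏ {zero} f = refl
∑ₚ-∏ {suc d} f = begin
  sum (λ v → ∑ₚ λ x → f zero v * ∏ λ k → f (suc k) (x k))
    ≡⟨ sum-cong-≗ (λ v → *-distribˡ-∑ₚ (f zero v) (λ x → ∏ λ k → f (suc k) (x k))) ⟨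
  sum (λ v → f zero v * ∑ₚ λ x → ∏ λ k → f (suc k) (x k))
    ≡⟨ sum-cong-≗ (λ v → cong (f zero v *_) (∑ₚ-∏ (f ∘ suc))) ⟩
  sum (λ v → f zero v * ∏ λ k → sum (f (suc k)))
    ≡⟨ *-distribʳ-sum _ (f zero) ⟨
  sum (f zero) * ∏ (λ k → sum (f (suc k)))
    ∎
  where open ≡-Reasoning

module _ {d : ℕ} {n : Fin d → ℕ} where

  _∈box?_ : (x : Point d n) (C : Cube d n) → Dec (x ∈box C)
  x ∈box? C = all? λ i → x i ∈? C i

  box-inhabited : ∀ {A : Cube d n} → IsBox A → ∃ (_∈box A)
  box-inhabited A-box = (λ i → proj₁ (A-box i)) , (λ i → proj₂ (A-box i))

  ⋃ : List (Cube d n) → Pred (Point d n) 0ℓ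
  ⋃ L x = Any (x ∈box_) L

  ⋃? : (L : List (Cube d n)) → Decidable (⋃ L)
  ⋃? L x = Any.any? (x ∈box?_) L

  PairwiseDichotomous : List (Cube d n) → Set
  PairwiseDichotomous L = ∀ A B → A ∈ L → B ∈ L → A ≢ B → Dichotomous A B

  dichotomous? : (A B : Cube d n) → Dec (Dichotomous A B)
  dichotomous? A B = any? λ i → ≡-dec Bool._≟_ (A i) (∁ (B i))

  dichotomous-sym : ∀ {A B : Cube d n} → Dichotomous A B → Dichotomous B A
  dichotomous-sym {A} {B} (i , Aᵢ≡∁Bᵢ) = i , (begin
    B i         ≡⟨ BooleanAlgebraProperties.¬-involutive (∪-∩-booleanAlgebra (n i)) (B i) ⟨
    ∁ (∁ (B i)) ≡⟨ cong ∁ Aᵢ≡∁Bᵢ ⟨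
    ∁ (A i)     ∎)
    where open ≡-Reasoning

  dichotomous⇒disjoint : ∀ {A B : Cube d n} {x} → Dichotomous A B → x ∈box A → ¬ x ∈box B
  dichotomous⇒disjoint {x = x} (i , Aᵢ≡∁Bᵢ) x∈A x∈B =
    x∈∁p⇒x∉p (subst (x i ∈ₛ_) Aᵢ≡∁Bᵢ (x∈A i)) (x∈B i)

  nonDichotomous⇒⊆ : ∀ {L} {A B : Cube d n} {x} → PairwiseDichotomous L → A ∈ L → B ∈ L →
                     ¬ Dichotomous A B → x ∈box A → x ∈box B
  nonDichotomous⇒⊆ {B = B} {x} L-pw A∈L B∈L ¬A⊥B x∈A =
    decidable-stable (x ∈box? B) λ x∉B → ¬A⊥B (L-pw _ _ A∈L B∈L λ { refl → x∉B x∈A })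

  ⋃-split : ∀ {L} {A : Cube d n} → PairwiseDichotomous L → A ∈ L →
            ⋃ L ≐ ⋃ (A ∷ filter (dichotomous? A) L)
  ⋃-split {L} {A} L-pw A∈L = split , merge
    where
    split : ⋃ L ⊆ ⋃ (A ∷ filter (dichotomous? A) L)
    split x∈⋃L with find x∈⋃L
    ... | B , B∈L , x∈B with dichotomous? A B
    ...   | yes A⊥B = there (lose (∈-filter⁺ (dichotomous? A) B∈L A⊥B) x∈B)
    ...   | no ¬A⊥B = here (nonDichotomous⇒⊆ L-pw B∈L A∈L (¬A⊥B ∘ dichotomous-sym) x∈B)
    merge : ⋃ (A ∷ filter (dichotomous? A) L) ⊆ ⋃ L
    merge (here x∈A) = lose A∈L x∈A
    merge (there x∈⋃L′) with find x∈⋃L′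
    ... | B , B∈L′ , x∈B = lose (proj₁ (∈-filter⁻ (dichotomous? A) B∈L′)) x∈B

  unionIs⇒≐ : ∀ {L L′ : List (Cube d n)} {F} → UnionIs L F → UnionIs L′ F → ⋃ L ≐ ⋃ L′
  unionIs⇒≐ L-F L′-F =
    (λ {x} → proj₁ (L′-F x) ∘ proj₂ (L-F x)) , (λ {x} → proj₁ (L-F x) ∘ proj₂ (L′-F x))

  suitsOfDisjoint⇒≢ : ∀ {L L′ : List (Cube d n)} {F G} → IsSuit L → UnionIs L F → UnionIs L′ G →
                      Disjoint F G → ∀ {A B} → A ∈ L → B ∈ L′ → A ≢ B
  suitsOfDisjoint⇒≢ (L-boxes , _) L-F L′-G F∩G=∅ {A} A∈L B∈L′ refl
    with box-inhabited (L-boxes A A∈L)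
  ... | x , x∈A = F∩G=∅ x (proj₂ (L-F x) (lose A∈L x∈A)) (proj₂ (L′-G x) (lose B∈L′ x∈A))

  ++-isSuit : ∀ {L L′ : List (Cube d n)} → IsSuit L → IsSuit L′ →
              (∀ A B → A ∈ L → B ∈ L′ → Dichotomous A B) → IsSuit (L ++ L′)
  ++-isSuit {L} {L′} (L-boxes , L-pw) (L′-boxes , L′-pw) L⊥L′ = boxes , pw
    where
    boxes : ∀ A → A ∈ L ++ L′ → IsBox A
    boxes A A∈ = [ L-boxes A , L′-boxes A ]′ (∈-++⁻ L A∈)
    pw : PairwiseDichotomous (L ++ L′)
    pw A B A∈ B∈ A≢B with ∈-++⁻ L A∈ | ∈-++⁻ L B∈
    ... | inj₁ A∈L  | inj₁ B∈L  = L-pw A B A∈L B∈L A≢B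
    ... | inj₁ A∈L  | inj₂ B∈L′ = L⊥L′ A B A∈L B∈L′
    ... | inj₂ A∈L′ | inj₁ B∈L  = dichotomous-sym (L⊥L′ B A B∈L A∈L′)
    ... | inj₂ A∈L′ | inj₂ B∈L′ = L′-pw A B A∈L′ B∈L′ A≢B

  ++-unionIs : ∀ {L L′ : List (Cube d n)} {F G} →
               UnionIs L F → UnionIs L′ G → UnionIs (L ++ L′) (F ∪ G)
  ++-unionIs {L} L-F L′-G x =
    [ ++⁺ˡ ∘ proj₁ (L-F x) , ++⁺ʳ L ∘ proj₁ (L′-G x) ]′ ,
    Sum.map (proj₂ (L-F x)) (proj₂ (L′-G x)) ∘ ++⁻ L

module Measure {d : ℕ} {n : Fin d → ℕ} (w : (k : Fin d) → Fin (n k) → ℤ) where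

  density : Point d n → ℤ
  density x = ∏ λ k → w k (x k)

  μ : {P : Pred (Point d n) p} → Decidable P → ℤ
  μ P? = ∑ₚ λ x → 𝟙 (P? x) * density x

  μ-cong : {P : Pred (Point d n) p} {Q : Pred (Point d n) q} →
           P ≐ Q → (P? : Decidable P) (Q? : Decidable Q) → μ P? ≡ μ Q?
  μ-cong (P⊆Q , Q⊆P) P? Q? = ∑ₚ-cong λ x → cong (_* density x) (𝟙-cong P⊆Q Q⊆P (P? x) (Q? x))

  μ-∅ : {P : Pred (Point d n) p} → (∀ x → ¬ P x) → (P? : Decidable P) → μ P? ≡ 0ℤ
  μ-∅ P=∅ P? = begin
    ∑ₚ (λ x → 𝟙 (P? x) * density x) ≡⟨ ∑ₚ-cong (λ x → cong (_* density x) (𝟙-no (P=∅ x) (P? x))) ⟩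
    ∑ₚ (λ x → 0ℤ * density x)       ≡⟨ *-distribˡ-∑ₚ 0ℤ density ⟨
    0ℤ * ∑ₚ density                 ≡⟨ *-zeroˡ (∑ₚ density) ⟩
    0ℤ                              ∎
    where open ≡-Reasoning

  μ-∪ : {P : Pred (Point d n) p} {Q : Pred (Point d n) q} → (∀ x → ¬ (P x × Q x)) →
        (P? : Decidable P) (Q? : Decidable Q) → μ (P? ∪? Q?) ≡ μ P? + μ Q?
  μ-∪ P∩Q=∅ P? Q? = trans
    (∑ₚ-cong λ x → trans (cong (_* density x) (𝟙-⊎ (P∩Q=∅ x) (P? x) (Q? x)))
                         (*-distribʳ-+ (density x) (𝟙 (P? x)) (𝟙 (Q? x))))
    (∑ₚ-distrib-+ (λ x → 𝟙 (P? x) * density x) (λ x → 𝟙 (Q? x) * density x))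

  μ-box : ∀ C → μ (_∈box? C) ≡ ∏ λ k → mass (C k) (w k)
  μ-box C = begin
    ∑ₚ (λ x → 𝟙 (x ∈box? C) * density x)
      ≡⟨ ∑ₚ-cong (λ x → cong (_* density x) (𝟙-∀ (λ k → x k ∈? C k) (x ∈box? C))) ⟩
    ∑ₚ (λ x → ∏ (λ k → 𝟙 (x k ∈? C k)) * density x)
      ≡⟨ ∑ₚ-cong (λ x → ∏-distrib-* (λ k → 𝟙 (x k ∈? C k)) (λ k → w k (x k))) ⟨
    ∑ₚ (λ x → ∏ λ k → 𝟙 (x k ∈? C k) * w k (x k))
      ≡⟨ ∑ₚ-∏ (λ k v → 𝟙 (v ∈? C k) * w k v) ⟩
    ∏ (λ k → mass (C k) (w k))
      ∎
    where open ≡-Reasoning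

  μ-dichotomous-null : ∀ {C D} → (∀ k → mass (∁ (D k)) (w k) ≡ 0ℤ) → Dichotomous C D →
                       μ (_∈box? C) ≡ 0ℤ
  μ-dichotomous-null {C} {D} ∁D-null (k , Cₖ≡∁Dₖ) =
    trans (μ-box C) (∏-zero _ k (trans (cong (λ T → mass T (w k)) Cₖ≡∁Dₖ) (∁D-null k)))

  μ-⋃-∷ : ∀ {A L} → (∀ B → B ∈ L → Dichotomous A B) →
          μ (⋃? (A ∷ L)) ≡ μ (_∈box? A) + μ (⋃? L)
  μ-⋃-∷ {A} {L} A⊥L = trans
    (μ-cong (Any.toSum , Any.fromSum) (⋃? (A ∷ L)) ((_∈box? A) ∪? ⋃? L))
    (μ-∪ disjoint (_∈box? A) (⋃? L))
    where
    disjoint : ∀ x → ¬ (x ∈box A × ⋃ L x)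
    disjoint x (x∈A , x∈⋃L) with find x∈⋃L
    ... | B , B∈L , x∈B = dichotomous⇒disjoint (A⊥L B B∈L) x∈A x∈B

  μ-⋃-null : ∀ {L} → PairwiseDichotomous L → (∀ C → C ∈ L → μ (_∈box? C) ≡ 0ℤ) →
             μ (⋃? L) ≡ 0ℤ
  μ-⋃-null {[]} _ _ = μ-∅ (λ _ ()) (⋃? [])
  μ-⋃-null {C ∷ L} C∷L-pw C∷L-null = cons (All.all? (dichotomous? C) L) (μ-⋃-null L-pw L-null)
    where
    L-pw : PairwiseDichotomous L
    L-pw A B A∈L B∈L = C∷L-pw A B (there A∈L) (there B∈L)
    L-null : ∀ A → A ∈ L → μ (_∈box? A) ≡ 0ℤ
    L-null A A∈L = C∷L-null A (there A∈L)
    cons : Dec (All (Dichotomous C) L) → μ (⋃? L) ≡ 0ℤ → μ (⋃? (C ∷ L)) ≡ 0ℤ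
    cons (yes C⊥L) μ⋃L≡0 = begin
      μ (⋃? (C ∷ L))           ≡⟨ μ-⋃-∷ (λ _ → All.lookup C⊥L) ⟩
      μ (_∈box? C) + μ (⋃? L)  ≡⟨ cong₂ _+_ (C∷L-null C (here refl)) μ⋃L≡0 ⟩
      0ℤ                       ∎
      where open ≡-Reasoning
    -- Lists may repeat a box: C then occurs again in L, and ⋃ (C ∷ L) = ⋃ L.
    cons (no ¬C⊥L) μ⋃L≡0 with find (¬All⇒Any¬ (dichotomous? C) L ¬C⊥L)
    ... | B , B∈L , ¬C⊥B = trans (μ-cong (absorb , there) (⋃? (C ∷ L)) (⋃? L)) μ⋃L≡0
      where
      absorb : ⋃ (C ∷ L) ⊆ ⋃ L
      absorb (here x∈C) = lose B∈L (nonDichotomous⇒⊆ C∷L-pw (here refl) (there B∈L) ¬C⊥B x∈C)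
      absorb (there x∈⋃L) = x∈⋃L

  μ-⋃-member : ∀ {L A} → PairwiseDichotomous L → A ∈ L →
               (∀ C → Dichotomous C A → μ (_∈box? C) ≡ 0ℤ) → μ (⋃? L) ≡ μ (_∈box? A)
  μ-⋃-member {L} {A} L-pw A∈L ⊥A-null = begin
    μ (⋃? L)                  ≡⟨ μ-cong (⋃-split L-pw A∈L) (⋃? L) (⋃? (A ∷ L′)) ⟩
    μ (⋃? (A ∷ L′))           ≡⟨ μ-⋃-∷ (λ _ → proj₂ ∘ ∈L′⁻) ⟩
    μ (_∈box? A) + μ (⋃? L′)  ≡⟨ cong (μ (_∈box? A) +_) (μ-⋃-null L′-pw L′-null) ⟩
    μ (_∈box? A) + 0ℤ         ≡⟨ +-identityʳ _ ⟩
    μ (_∈box? A)              ∎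
    where
    open ≡-Reasoning
    L′ : List (Cube d n)
    L′ = filter (dichotomous? A) L
    ∈L′⁻ : ∀ {C} → C ∈ L′ → C ∈ L × Dichotomous A C
    ∈L′⁻ = ∈-filter⁻ (dichotomous? A) {xs = L}
    L′-pw : PairwiseDichotomous L′
    L′-pw B C B∈L′ C∈L′ = L-pw B C (proj₁ (∈L′⁻ B∈L′)) (proj₁ (∈L′⁻ C∈L′))
    L′-null : ∀ C → C ∈ L′ → μ (_∈box? C) ≡ 0ℤ
    L′-null C C∈L′ = ⊥A-null C (dichotomous-sym (proj₂ (∈L′⁻ C∈L′)))

dichotomous-transfer : ∀ {d} {n : Fin d → ℕ} {L L* : List (Cube d n)} {D} →
                       PairwiseDichotomous L → IsSuit L* → ⋃ L ≐ ⋃ L* → IsBox D →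
                       (∀ C → C ∈ L → Dichotomous C D) → ∀ A → A ∈ L* → Dichotomous A D
dichotomous-transfer {d} {L = L} {L*} {D} L-pw (L*-boxes , L*-pw) ⋃L≐⋃L* D-box L⊥D A A∈L*
  with dichotomous? A D
... | yes A⊥D = A⊥D
... | no ¬A⊥D = ⊥-elim (0≢1 (begin
  0ℤ                                ≡⟨ μ-⋃-null L-pw (λ C → μ-dichotomous-null mass-∁R ∘ L⊥D C) ⟨
  μ (⋃? L)                          ≡⟨ μ-cong ⋃L≐⋃L* (⋃? L) (⋃? L*) ⟩
  μ (⋃? L*)                         ≡⟨ μ-⋃-member L*-pw A∈L* (λ _ → μ-dichotomous-null mass-∁S) ⟩
  μ (_∈box? A)                      ≡⟨ μ-box A ⟩
  ∏ (λ k → mass (A k) (weight k))   ≡⟨ ∏-cong-≗ mass-S ⟩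
  ∏ (λ (_ : Fin d) → 1ℤ)            ≡⟨ ∏-replicate-one d ⟩
  1ℤ                                ∎))
  where
  open ≡-Reasoning
  0≢1 : 0ℤ ≢ 1ℤ
  0≢1 ()
  separating : ∀ k → SeparatingWeight (A k) (D k)
  separating k =
    separatingWeight (proj₂ (L*-boxes A A∈L* k)) (proj₂ (D-box k)) (λ Aₖ≡∁Dₖ → ¬A⊥D (k , Aₖ≡∁Dₖ))
  open module Separating k = SeparatingWeight (separating k)
  open Measure weight

proposition2p6 : (d : ℕ) (n : Fin d → ℕ) → ((i : Fin d) → 0 < n i)
    → (F G : Pred (Point d n) 0ℓ)
    → IsPolybox F → IsPolybox G → Disjoint F G
    → (∃ λ (𝓕 : List (Cube d n)) → ∃ λ (𝓖 : List (Cube d n)) →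
         IsProperSuitFor 𝓕 F × IsProperSuitFor 𝓖 G × IsSuitFor (𝓕 ++ 𝓖) (F ∪ G))
    → (𝓕* 𝓖* : List (Cube d n))
    → IsProperSuitFor 𝓕* F → IsProperSuitFor 𝓖* G
    → IsSuitFor (𝓕* ++ 𝓖*) (F ∪ G)
proposition2p6 d n _ F G _ _ F∩G=∅
  (𝓕 , 𝓖 , ((𝓕-suit , _) , 𝓕-F) , ((𝓖-suit , _) , 𝓖-G) , (𝓕++𝓖-suit , _))
  𝓕* 𝓖* ((𝓕*-suit , _) , 𝓕*-F) ((𝓖*-suit , _) , 𝓖*-G) =
  ++-isSuit 𝓕*-suit 𝓖*-suit 𝓕*⊥𝓖* , ++-unionIs 𝓕*-F 𝓖*-G
  where
  𝓕⊥𝓖 : ∀ A B → A ∈ 𝓕 → B ∈ 𝓖 → Dichotomous A B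
  𝓕⊥𝓖 A B A∈𝓕 B∈𝓖 = proj₂ 𝓕++𝓖-suit A B (∈-++⁺ˡ A∈𝓕) (∈-++⁺ʳ 𝓕 B∈𝓖)
    (suitsOfDisjoint⇒≢ 𝓕-suit 𝓕-F 𝓖-G F∩G=∅ A∈𝓕 B∈𝓖)
  𝓕*⊥𝓖 : ∀ A B → A ∈ 𝓕* → B ∈ 𝓖 → Dichotomous A B
  𝓕*⊥𝓖 A B A∈𝓕* B∈𝓖 = dichotomous-transfer (proj₂ 𝓕-suit) 𝓕*-suit (unionIs⇒≐ 𝓕-F 𝓕*-F)
    (proj₁ 𝓖-suit B B∈𝓖) (λ C C∈𝓕 → 𝓕⊥𝓖 C B C∈𝓕 B∈𝓖) A A∈𝓕*
  𝓕*⊥𝓖* : ∀ A B → A ∈ 𝓕* → B ∈ 𝓖* → Dichotomous A B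
  𝓕*⊥𝓖* A B A∈𝓕* B∈𝓖* = dichotomous-sym (dichotomous-transfer (proj₂ 𝓖-suit) 𝓖*-suit
    (unionIs⇒≐ 𝓖-G 𝓖*-G) (proj₁ 𝓕*-suit A A∈𝓕*)
    (λ C C∈𝓖 → dichotomous-sym (𝓕*⊥𝓖 A C A∈𝓕* C∈𝓖)) B B∈𝓖*)
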